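{- Let $S$ be a snake of $\mathbf b\in\mathbb N^n$ and let $T\in\mathcal G(S)$. Then $\mathrm{maj}(\hat T)=\mathrm{coinv}(\hat T)=0$.
   Context: Cells $(c,r)$: column $c$, row $r$, row 1 at the bottom. $\mathbb D(\mathbf a)=\{(c,r)\in\mathbb Z_{>0}\times[n]:c\le\mathbf a_r\}$. For a filling $T:\mathbb D(\mathbf a)\to[n]$, $\hat T$ extends it by basement cells $(0,i)$, $\hat T(0,i)=i$. For $u\in\mathbb D(\mathbf a)$, $\mathrm{left}(u)$ is the cell immediately left of $u$ (possibly a basement cell) and $\mathrm{leg}(u)$ the number of cells weakly right of $u$ in its row; $\mathrm{maj}(\hat T)=\sum\mathrm{leg}(u)$ over $u$ with $\hat T(u)>\hat T(\mathrm{left}(u))$. A co-inversion triple is a set of three cells of $\hat T$ with distinct entries of the form $(c,r),(c+1,r),(c,s)$ with $r<s$, $\mathbf a_r>\mathbf a_s$, or $(c+1,r),(c,s),(c+1,s)$ with $r<s$, $\mathbf a_r\le\mathbf a_s$ ($c\ge0$), such that with $k,i$ the left and right entries in the common row and $j$ the third entry, $i<j<k$ or $j<k<i$ or $k<i<j$; $\mathrm{coinv}(\hat T)$ is their number. Cells attack if in the same column or in adjacent columns with the left one strictly higher. An SSKT is a filling with no two attacking cells of $\hat T$ equal, $\mathrm{maj}(\hat T)=0$ and $\mathrm{coinv}(\hat T)=0$. Key poset: $\mathbf a\preceq\mathbf b$ iff $\mathbf a_i\le\mathbf b_i$ for all $i$ and $\mathbf a_i>\mathbf a_j$ with $i<j$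 implies $\mathbf b_i>\mathbf b_j$. Cells are weakly connected if they share a column or lie in adjacent columns with the left one weakly higher; a set is weakly connected if it forms one class under the transitive closure. A snake of $\mathbf b$ is $S\subseteq\mathbb D(\mathbf b)$ with (1) $S$ weakly connected, (2) $\mathbb D(\mathbf b)\setminus S=\mathbb D(\mathbf a)$ for some $\mathbf a\preceq\mathbf b$, (3) no three cells $(c,s),(c+1,s),(c+1,r)$ with $r<s$ in $S$. For such $S$, $\mathcal G(S)$ is the set of maps $T:\mathbb D(\mathbf b)\to[n]$ such that $T$ restricted to $\mathbb D(\mathbf b)\setminus S=\mathbb D(\mathbf a)$ is an SSKT (of shape $\mathbf a$) and $T$ is identically $1$ on $S$; $\mathrm{maj}(\hat T)$ and $\mathrm{coinv}(\hat T)$ are computed for $T$ as a filling of $\mathbb D(\mathbf b)$. -}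

module Defs where

open import Data.Nat using (ℕ; zero; suc; _+_; _∸_; _≤_; _<_; _<ᵇ_; _≡ᵇ_)
open import Data.Nat.ListAction using (sum)
open import Data.Bool using (Bool; true; false; if_then_else_; _∧_; _∨_; not)
open import Data.Fin using (Fin; toℕ)
open import Data.List using (List; map; upTo; allFin; concatMap)
open import Data.Product using (_×_; ∃)
open import Data.Sum using (_⊎_)
open import Relation.Binary.PropositionalEquality using (_≡_; _≢_)
open import Relation.Nullary using (¬_)
open import Relation.Binary.Construct.Closure.ReflexiveTransitive using (Star)

-- Conventions: rows are indexed by Fin n, row r : Fin n is row (toℕ r + 1)
-- of the paper (row 1 at the bottom).  A filling is a map T : ℕ → Fin n → ℕ (column, row ↦ entry);
-- only its values on cells (c , r) with 1 ≤ c ≤ a r are ever consulted.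

Comp : ℕ → Set
Comp n = Fin n → ℕ

Filling : ℕ → Set
Filling n = ℕ → Fin n → ℕ

InD : ∀ {n} → Comp n → ℕ → Fin n → Set
InD a c r = 1 ≤ c × c ≤ a r

-- the extended filling T̂ : basement cell (0 , i) has entry i (1-indexed)
hat : ∀ {n} → Filling n → ℕ → Fin n → ℕ
hat T zero    r = suc (toℕ r)
hat T (suc c) r = T (suc c) r

Σ[_]_ : {A : Set} → List A → (A → ℕ) → ℕ
Σ[ xs ] f = sum (map f xs)

-- maj(T̂) for a filling of D(a): sum of leg(u) = a_r - c + 1 over cells
-- u = (c , r) of D(a) with T̂(u) > T̂(left u)
maj : ∀ {n} → Comp n → Filling n → ℕ
maj {n} a T =
  Σ[ allFin n ] λ r → Σ[ upTo (a r) ] λ k →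
    if hat T k r <ᵇ hat T (suc k) r then a r ∸ suc k + 1 else 0

-- the co-inversion condition for left entry k, right entry i, third entry j
coinvCond : ℕ → ℕ → ℕ → Bool
coinvCond k i j =
  not (k ≡ᵇ i) ∧ not (i ≡ᵇ j) ∧ not (k ≡ᵇ j) ∧
  (((i <ᵇ j) ∧ (j <ᵇ k)) ∨ ((j <ᵇ k) ∧ (k <ᵇ i)) ∨ ((k <ᵇ i) ∧ (i <ᵇ j)))

infix 4 _≤ᵇ_
_≤ᵇ_ : ℕ → ℕ → Bool
m ≤ᵇ n = m <ᵇ suc n

ind : Bool → ℕ
ind true  = 1
ind false = 0

triple₁ : ∀ {n} → Comp n → Filling n → Fin n → Fin n → ℕ → Bool
triple₁ a T r s c =
  (toℕ r <ᵇ toℕ s) ∧ (a s <ᵇ a r) ∧ (suc c ≤ᵇ a r) ∧ (c ≤ᵇ a s) ∧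
  coinvCond (hat T c r) (hat T (suc c) r) (hat T c s)

triple₂ : ∀ {n} → Comp n → Filling n → Fin n → Fin n → ℕ → Bool
triple₂ a T r s c =
  (toℕ r <ᵇ toℕ s) ∧ (a r ≤ᵇ a s) ∧ (suc c ≤ᵇ a r) ∧ (suc c ≤ᵇ a s) ∧
  coinvCond (hat T c s) (hat T (suc c) s) (hat T (suc c) r)

-- coinv(T̂): the number of co-inversion triples.  In both types the column c
-- satisfies c + 1 ≤ a_r, so c ranges over upTo (a r).
coinv : ∀ {n} → Comp n → Filling n → ℕ
coinv {n} a T =
  Σ[ allFin n ] λ r → Σ[ allFin n ] λ s → Σ[ upTo (a r) ] λ c →
    ind (triple₁ a T r s c) + ind (triple₂ a T r s c)

NonAttacking : ∀ {n} → Comp n → Filling n → Set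
NonAttacking a T =
  (∀ c r s → r ≢ s → c ≤ a r → c ≤ a s → hat T c r ≢ hat T c s) ×
  (∀ c r s → toℕ r < toℕ s → c ≤ a s → suc c ≤ a r →
     hat T c s ≢ hat T (suc c) r)

SSKT : ∀ {n} → Comp n → Filling n → Set
SSKT {n} a T =
  (∀ c r → InD a c r → 1 ≤ T c r × T c r ≤ n) ×
  NonAttacking a T × maj a T ≡ 0 × coinv a T ≡ 0

_⪯_ : ∀ {n} → Comp n → Comp n → Set
a ⪯ b = (∀ i → a i ≤ b i) ×
        (∀ i j → toℕ i < toℕ j → a j < a i → b j < b i)

CellSet : ℕ → Set₁
CellSet n = ℕ → Fin n → Set

WeakAdj : ∀ {n} → ℕ → Fin n → ℕ → Fin n → Set
WeakAdj c r c′ s =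
  c ≡ c′ ⊎ (c′ ≡ suc c × toℕ s ≤ toℕ r) ⊎ (c ≡ suc c′ × toℕ r ≤ toℕ s)

data Cell (n : ℕ) : Set where
  cell : ℕ → Fin n → Cell n

AdjIn : ∀ {n} → CellSet n → Cell n → Cell n → Set
AdjIn S (cell c r) (cell c′ s) = S c r × S c′ s × WeakAdj c r c′ s

WeaklyConnected : ∀ {n} → CellSet n → Set
WeaklyConnected {n} S =
  (∃ λ c → ∃ λ r → S c r) ×
  (∀ c r c′ s → S c r → S c′ s → Star (AdjIn S) (cell c r) (cell c′ s))

IsSnake : ∀ {n} → Comp n → CellSet n → Comp n → Set
IsSnake b S a =
  (∀ c r → S c r → InD b c r) ×
  WeaklyConnected S ×
  (∀ c r → ((InD b c r × ¬ S c r) → InD a c r) × (InD a c r → (InD b c r × ¬ S c r))) ×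
  a ⪯ b ×
  (∀ c r s → toℕ r < toℕ s → ¬ (S c s × S (suc c) s × S (suc c) r))

InG : ∀ {n} → CellSet n → Comp n → Filling n → Set
InG S a T = SSKT a T × (∀ c r → S c r → T c r ≡ 1)

-- Every cell of D(b) lies in D(a) or carries the entry 1, which is the smallest
-- entry.  Hence the rows of T̂ stay weakly decreasing, so maj vanishes, and in
-- every candidate co-inversion triple the right entry i is at most the left
-- entry k, so only the pattern i < j < k is possible.  Such a triple would be a
-- co-inversion triple of the SSKT on D(a), or put an entry strictly below a 1,
-- or contradict a ⪯ b, or contradict the strict increase up the columns of D(a)
-- between rows r < s with a_r ≤ a_s.

module Submission where

open import Defs
open import Data.Nat using (ℕ; zero; suc; _+_; _≤_; _<_; _≮_; _<ᵇ_; _≡ᵇ_; z≤n; s≤s; s≤s⁻¹)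
open import Data.Nat.Properties
open import Data.Nat.ListAction using (sum)
open import Data.Bool using (true; false; if_then_else_; _∧_; _∨_; not; T)
open import Data.Bool.Properties using (T-∧; T-∨; T-not-≡)
open import Data.Fin using (Fin; toℕ)
open import Data.List using (_∷_; []; map; upTo; allFin)
open import Data.List.Membership.Propositional using (_∈_)
open import Data.List.Membership.Propositional.Properties using (∈-upTo⁺; ∈-upTo⁻; ∈-allFin)
open import Data.List.Relation.Unary.Any using (here; there)
open import Data.Product using (_×_; _,_; proj₁; proj₂)
open import Data.Product.Function.NonDependent.Propositional using (_×-⇔_)
open import Data.Sum using (inj₁; inj₂)
open import Function using (_∘_; _∘′_)
open import Function.Bundles using (_⇔_; mk⇔; Equivalence)
open import Function.Properties.Equivalence using () renaming (refl to ⇔-refl; trans to ⇔-trans)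
open import Relation.Nullary using (¬_; yes; no; contradiction)
open import Relation.Binary using (tri<; tri≈; tri>)
open import Relation.Binary.PropositionalEquality using (_≡_; _≢_; refl; sym; ≢-sym)

open Equivalence using (to; from)

sum-map≡0⁻ : ∀ {A : Set} (f : A → ℕ) xs → sum (map f xs) ≡ 0 → ∀ {x} → x ∈ xs → f x ≡ 0
sum-map≡0⁻ f (y ∷ ys) Σ≡0 (here refl) = m+n≡0⇒m≡0 (f y) Σ≡0
sum-map≡0⁻ f (y ∷ ys) Σ≡0 (there x∈ys) = sum-map≡0⁻ f ys (m+n≡0⇒n≡0 (f y) Σ≡0) x∈ys

sum-map≡0⁺ : ∀ {A : Set} (f : A → ℕ) xs → (∀ {x} → x ∈ xs → f x ≡ 0) → sum (map f xs) ≡ 0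
sum-map≡0⁺ f []       _    = refl
sum-map≡0⁺ f (y ∷ ys) f≡0 rewrite f≡0 (here refl) = sum-map≡0⁺ f ys (f≡0 ∘ there)

¬T⇒≡false : ∀ {x} → ¬ T x → x ≡ false
¬T⇒≡false {false} _  = refl
¬T⇒≡false {true}  ¬t = contradiction _ ¬t

T-<ᵇ : ∀ {m n} → T (m <ᵇ n) ⇔ m < n
T-<ᵇ {m} {n} = mk⇔ (<ᵇ⇒< m n) <⇒<ᵇ

T-≤ᵇ : ∀ {m n} → T (m ≤ᵇ n) ⇔ m ≤ n
T-≤ᵇ {m} {n} = mk⇔ (s≤s⁻¹ ∘′ <ᵇ⇒< m (suc n)) (<⇒<ᵇ ∘′ s≤s)

T-not-≡ᵇ : ∀ {m n} → m ≢ n → T (not (m ≡ᵇ n))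
T-not-≡ᵇ {m} {n} m≢n = from T-not-≡ (¬T⇒≡false (m≢n ∘ ≡ᵇ⇒≡ m n))

ind+ind≡0⇔ : ∀ x y → ind x + ind y ≡ 0 ⇔ (¬ T x × ¬ T y)
ind+ind≡0⇔ false false = mk⇔ (λ _ → (λ ()) , (λ ())) (λ _ → refl)
ind+ind≡0⇔ false true  = mk⇔ (λ ()) (λ (_ , ¬t) → contradiction _ ¬t)
ind+ind≡0⇔ true  _     = mk⇔ (λ ()) (λ (¬t , _) → contradiction _ ¬t)

if-then-+1≡0⇔ : ∀ x m → (if x then m + 1 else 0) ≡ 0 ⇔ (¬ T x)
if-then-+1≡0⇔ false m = mk⇔ (λ _ ()) (λ _ → refl)
if-then-+1≡0⇔ true  m = mk⇔ (λ m+1≡0 → contradiction (m+n≡0⇒n≡0 m m+1≡0) λ ())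
                            (λ ¬t → contradiction _ ¬t)

coinvCond-intro : ∀ {k i j} → i < j → j < k → T (coinvCond k i j)
coinvCond-intro {k} {i} {j} i<j j<k =
  from T-∧ (T-not-≡ᵇ (≢-sym (<⇒≢ i<k)) ,
  from T-∧ (T-not-≡ᵇ (<⇒≢ i<j) ,
  from T-∧ (T-not-≡ᵇ (≢-sym (<⇒≢ j<k)) ,
  from (T-∨ {(i <ᵇ j) ∧ (j <ᵇ k)}) (inj₁ (from T-∧ (<⇒<ᵇ i<j , <⇒<ᵇ j<k))))))
  where i<k = <-trans i<j j<k

coinvCond⇒cyclic : ∀ {k i j} → T (coinvCond k i j) →
  T (((i <ᵇ j) ∧ (j <ᵇ k)) ∨ ((j <ᵇ k) ∧ (k <ᵇ i)) ∨ ((k <ᵇ i) ∧ (i <ᵇ j)))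
coinvCond⇒cyclic {k} {i} {j} =
  proj₂ ∘ to (T-∧ {not (k ≡ᵇ j)}) ∘ proj₂ ∘ to (T-∧ {not (i ≡ᵇ j)}) ∘ proj₂ ∘ to (T-∧ {not (k ≡ᵇ i)})

coinvCond-elim : ∀ {k i j} → i ≤ k → T (coinvCond k i j) → i < j × j < k
coinvCond-elim {k} {i} {j} i≤k t with to (T-∨ {(i <ᵇ j) ∧ (j <ᵇ k)}) (coinvCond⇒cyclic {k} {i} {j} t)
... | inj₁ i<j<k = let (i<j , j<k) = to T-∧ i<j<k in <ᵇ⇒< i j i<j , <ᵇ⇒< j k j<k
... | inj₂ other with to (T-∨ {(j <ᵇ k) ∧ (k <ᵇ i)}) other
...   | inj₁ j<k<i = contradiction i≤k (<⇒≱ (<ᵇ⇒< k i (proj₂ (to (T-∧ {j <ᵇ k}) j<k<i))))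
...   | inj₂ k<i<j = contradiction i≤k (<⇒≱ (<ᵇ⇒< k i (proj₁ (to (T-∧ {k <ᵇ i}) k<i<j))))

RowsNonincreasing : ∀ {n} → Comp n → Filling n → Set
RowsNonincreasing a F = ∀ r k → suc k ≤ a r → hat F (suc k) r ≤ hat F k r

maj≡0⇔rowsNonincreasing : ∀ {n} {a : Comp n} {F} → maj a F ≡ 0 ⇔ RowsNonincreasing a F
maj≡0⇔rowsNonincreasing {n} {a} {F} = mk⇔ rows⁺ rows⁻
  where
  rows⁺ : maj a F ≡ 0 → RowsNonincreasing a F
  rows⁺ maj≡0 r k k<ar = ≮⇒≥ (to (if-then-+1≡0⇔ _ _) summand≡0 ∘ <⇒<ᵇ)
    where
    summand≡0 = sum-map≡0⁻ _ (upTo (a r))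
                  (sum-map≡0⁻ _ (allFin n) maj≡0 (∈-allFin r)) (∈-upTo⁺ k<ar)
  rows⁻ : RowsNonincreasing a F → maj a F ≡ 0
  rows⁻ rows = sum-map≡0⁺ _ (allFin n) λ {r} _ → sum-map≡0⁺ _ (upTo (a r)) λ {k} k∈ →
    from (if-then-+1≡0⇔ _ _) (≤⇒≯ (rows r k (∈-upTo⁻ k∈)) ∘ <ᵇ⇒< _ _)

CoinvTriple₁ : ∀ {n} → Comp n → Filling n → Fin n → Fin n → ℕ → Set
CoinvTriple₁ a F r s c =
  toℕ r < toℕ s × a s < a r × suc c ≤ a r × c ≤ a s ×
  T (coinvCond (hat F c r) (hat F (suc c) r) (hat F c s))

CoinvTriple₂ : ∀ {n} → Comp n → Filling n → Fin n → Fin n → ℕ → Set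
CoinvTriple₂ a F r s c =
  toℕ r < toℕ s × a r ≤ a s × suc c ≤ a r × suc c ≤ a s ×
  T (coinvCond (hat F c s) (hat F (suc c) s) (hat F (suc c) r))

T-triple₁ : ∀ {n} {a : Comp n} {F r s c} → T (triple₁ a F r s c) ⇔ CoinvTriple₁ a F r s c
T-triple₁ = ⇔-trans T-∧ (T-<ᵇ ×-⇔ ⇔-trans T-∧ (T-<ᵇ ×-⇔
            ⇔-trans T-∧ (T-≤ᵇ ×-⇔ ⇔-trans T-∧ (T-≤ᵇ ×-⇔ ⇔-refl))))

T-triple₂ : ∀ {n} {a : Comp n} {F r s c} → T (triple₂ a F r s c) ⇔ CoinvTriple₂ a F r s c
T-triple₂ = ⇔-trans T-∧ (T-<ᵇ ×-⇔ ⇔-trans T-∧ (T-≤ᵇ ×-⇔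
            ⇔-trans T-∧ (T-≤ᵇ ×-⇔ ⇔-trans T-∧ (T-≤ᵇ ×-⇔ ⇔-refl))))

NoCoinvTriples : ∀ {n} → Comp n → Filling n → Set
NoCoinvTriples a F =
  (∀ r s c → ¬ CoinvTriple₁ a F r s c) × (∀ r s c → ¬ CoinvTriple₂ a F r s c)

coinv≡0⇔noCoinvTriples : ∀ {n} {a : Comp n} {F} → coinv a F ≡ 0 ⇔ NoCoinvTriples a F
coinv≡0⇔noCoinvTriples {n} {a} {F} = mk⇔ triples⁺ triples⁻
  where
  triples⁺ : coinv a F ≡ 0 → NoCoinvTriples a F
  triples⁺ coinv≡0 =
    (λ { r s c t@(_ , _ , c<ar , _) → proj₁ (summand≡0 r s c c<ar) (from T-triple₁ t) }) ,
    (λ { r s c t@(_ , _ , c<ar , _) → proj₂ (summand≡0 r s c c<ar) (from T-triple₂ t) })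
    where
    summand≡0 : ∀ r s c → c < a r → ¬ T (triple₁ a F r s c) × ¬ T (triple₂ a F r s c)
    summand≡0 r s c c<ar = to (ind+ind≡0⇔ _ _)
      (sum-map≡0⁻ _ (upTo (a r)) (sum-map≡0⁻ _ (allFin n)
        (sum-map≡0⁻ _ (allFin n) coinv≡0 (∈-allFin r)) (∈-allFin s)) (∈-upTo⁺ c<ar))
  triples⁻ : NoCoinvTriples a F → coinv a F ≡ 0
  triples⁻ (no₁ , no₂) =
    sum-map≡0⁺ _ (allFin n) λ {r} _ → sum-map≡0⁺ _ (allFin n) λ {s} _ →
    sum-map≡0⁺ _ (upTo (a r)) λ {c} _ →
      from (ind+ind≡0⇔ _ _) (no₁ r s c ∘ to T-triple₁ , no₂ r s c ∘ to T-triple₂)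

module SnakeFilling {n} {a b : Comp n} {S : CellSet n} {F : Filling n}
  (D[b]∖S⊆D[a] : ∀ c r → InD b c r × ¬ S c r → InD a c r)
  (a⪯b : a ⪯ b)
  (entries-positive : ∀ c r → InD a c r → 1 ≤ F c r)
  (columns-distinct : ∀ c r s → r ≢ s → c ≤ a r → c ≤ a s → hat F c r ≢ hat F c s)
  (rows-a : RowsNonincreasing a F)
  (noCoinv-a : NoCoinvTriples a F)
  (F≡1-on-S : ∀ c r → S c r → F c r ≡ 1)
  where

  -- Comparing the entry with 1 avoids deciding membership in S.
  hat≡1-outside-a : ∀ {c r} → c ≤ b r → a r < c → hat F c r ≡ 1
  hat≡1-outside-a {suc c} {r} c<br ar≤c with F (suc c) r ≟ 1
  ... | yes F≡1 = F≡1
  ... | no  F≢1 = contradiction (proj₂ (D[b]∖S⊆D[a] (suc c) r in-b∖S)) (<⇒≱ ar≤c)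
    where in-b∖S = (s≤s z≤n , c<br) , F≢1 ∘ F≡1-on-S (suc c) r

  hat-positive : ∀ {c r} → c ≤ b r → 1 ≤ hat F c r
  hat-positive {zero}      _ = s≤s z≤n
  hat-positive {suc c} {r} c<br with suc c ≤? a r
  ... | yes c<ar = entries-positive (suc c) r (s≤s z≤n , c<ar)
  ... | no  c≮ar = ≤-reflexive (sym (hat≡1-outside-a c<br (≰⇒> c≮ar)))

  hat-≮-outside-a : ∀ {c r c′ r′} → c ≤ b r → c′ ≤ b r′ → a r′ < c′ → hat F c r ≮ hat F c′ r′
  hat-≮-outside-a c≤br c′≤br′ ar′<c′ lt =
    <⇒≱ (≤-trans lt (≤-reflexive (hat≡1-outside-a c′≤br′ ar′<c′))) (hat-positive c≤br)

  rows-b : RowsNonincreasing b F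
  rows-b r k k<br with suc k ≤? a r
  ... | yes k<ar = rows-a r k k<ar
  ... | no  k≮ar rewrite hat≡1-outside-a k<br (≰⇒> k≮ar) = hat-positive (<⇒≤ k<br)

  columns-increasing : ∀ {r s} → toℕ r < toℕ s → a r ≤ a s →
                       ∀ c → c ≤ a r → hat F c r < hat F c s
  columns-increasing r<s _ zero _ = s≤s r<s
  columns-increasing {r} {s} r<s ar≤as (suc c) c<ar
    with <-cmp (hat F (suc c) r) (hat F (suc c) s)
  ... | tri< lt _ _ = lt
  ... | tri≈ _ eq _ =
    contradiction eq (columns-distinct (suc c) r s r≢s c<ar (≤-trans c<ar ar≤as))
    where r≢s : r ≢ s
          r≢s refl = <-irrefl refl r<s
  ... | tri> _ _ gt = contradiction
    (r<s , ar≤as , c<ar , ≤-trans c<ar ar≤as , coinvCond-intro gt (≤-<-trans (rows-a r c c<ar) ih))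
    (proj₂ noCoinv-a r s c)
    where ih = columns-increasing r<s ar≤as c (<⇒≤ c<ar)

  noCoinv-b : NoCoinvTriples b F
  noCoinv-b = no₁ , no₂
    where
    no₁ : ∀ r s c → ¬ CoinvTriple₁ b F r s c
    no₁ r s c (r<s , _ , c<br , c≤bs , t) with coinvCond-elim (rows-b r c c<br) t
    ... | i<j , j<k with c ≤? a s
    ...   | no  c≰as = hat-≮-outside-a c<br c≤bs (≰⇒> c≰as) i<j
    ...   | yes c≤as with a s <? a r
    ...     | yes as<ar = proj₁ noCoinv-a r s c
                            (r<s , as<ar , ≤-<-trans c≤as as<ar , c≤as , coinvCond-intro i<j j<k)
    ...     | no  as≮ar with c ≤? a r
    ...       | yes c≤ar = <-asym j<k (columns-increasing r<s (≮⇒≥ as≮ar) c c≤ar)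
    ...       | no  c≰ar = hat-≮-outside-a c≤bs (<⇒≤ c<br) (≰⇒> c≰ar) j<k

    no₂ : ∀ r s c → ¬ CoinvTriple₂ b F r s c
    no₂ r s c (r<s , br≤bs , c<br , c<bs , t) with coinvCond-elim (rows-b s c c<bs) t
    ... | i<j , j<k with suc c ≤? a r
    ...   | no  c≮ar = hat-≮-outside-a c<bs c<br (≰⇒> c≮ar) i<j
    ...   | yes c<ar with a s <? a r
    ...     | yes as<ar = <⇒≱ (proj₂ a⪯b r s r<s as<ar) br≤bs
    ...     | no  as≮ar = proj₂ noCoinv-a r s c
                            (r<s , ar≤as , c<ar , ≤-trans c<ar ar≤as , coinvCond-intro i<j j<k)
      where ar≤as = ≮⇒≥ as≮ar

lemma7p9 : ∀ (n : ℕ) (b : Comp n) (S : CellSet n) (a : Comp n) (T : Filling n) →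
    IsSnake b S a → InG S a T → maj b T ≡ 0 × coinv b T ≡ 0
lemma7p9 n b S a F (_ , _ , D[b]∖S≃D[a] , a⪯b , _)
                   ((bounds , (columns-distinct , _) , maj≡0 , coinv≡0) , F≡1-on-S) =
  from maj≡0⇔rowsNonincreasing rows-b , from coinv≡0⇔noCoinvTriples noCoinv-b
  where
  open SnakeFilling (λ c r → proj₁ (D[b]∖S≃D[a] c r)) a⪯b (λ c r → proj₁ ∘ bounds c r)
         columns-distinct (to maj≡0⇔rowsNonincreasing maj≡0)
         (to coinv≡0⇔noCoinvTriples coinv≡0) F≡1-on-S
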